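{- Let $G$ be a bipartite graph with color classes $X$ and $Y$, with no universal vertex and no induced domino. Then for any $B^1,B^2\in\mathcal{B}(G)$ with $B^1\parallel B^2$ (incomparable), one has: if $B^1\wedge B^2\neq\bot$ then $B^1\vee B^2=\top$; and if $B^1\vee B^2\neq\top$ then $B^1\wedge B^2=\bot$, where $\wedge,\vee$ are meet and join in the lattice $\mathcal{L}(G)$.
   Context: A universal vertex is a vertex adjacent to all vertices of the opposite color class. A domino is the graph obtained from the 6-cycle $C_6$ by adding a chord joining two antipodal vertices. A biclique is a pair $B=(U,W)$, $U\subseteq X$, $W\subseteq Y$, with all of $U$ adjacent to all of $W$; $X(B)=U$, $Y(B)=W$. $\mathcal{B}(G)$ is the set of maximal bicliques (inclusion-wise maximal vertex sets inducing complete bipartite subgraphs), ordered by $B\preceq B'$ iff $X(B)\subseteq X(B')$ (equivalently $Y(B)\supseteq Y(B')$). $\mathcal{L}(G)$ is the lattice $(\mathcal{B}(G)\cup\{\bot,\top\},\preceq)$ where $\bot,\top$ are dummy elements with $X(\bot)=\emptyset$, $Y(\bot)=Y$, $X(\top)=X$, $Y(\top)=\emptyset$ (the Galois lattice of $G$). -}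

module Defs where

open import Data.Nat using (ℕ)
open import Data.Bool using (Bool; true)
open import Data.Fin using (Fin)
open import Data.Fin.Subset using (Subset; _∈_; _⊆_; Nonempty) renaming (⊥ to ∅; ⊤ to full)
open import Data.Product using (_×_; _,_; proj₁; proj₂; Σ; ∃)
open import Data.Sum using (_⊎_)
open import Relation.Binary.PropositionalEquality using (_≡_; _≢_)
open import Relation.Nullary using (¬_)

-- A finite bipartite graph with color classes X = Fin m and Y = Fin n,
-- given by its (bipartite) adjacency relation between X and Y.
BipGraph : ℕ → ℕ → Set
BipGraph m n = Fin m → Fin n → Bool

module _ {m n : ℕ} (G : BipGraph m n) where

  Adj : Fin m → Fin n → Set
  Adj x y = G x y ≡ true

  UniversalX : Fin m → Set
  UniversalX x = ∀ y → Adj x y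

  UniversalY : Fin n → Set
  UniversalY y = ∀ x → Adj x y

  NoUniversalVertex : Set
  NoUniversalVertex = (∀ x → ¬ UniversalX x) × (∀ y → ¬ UniversalY y)

  -- Induced domino: x₁ y₁ x₂ y₃ x₃ y₂ is a 6-cycle, x₂y₂ is the chord
  -- joining antipodal vertices; x₁y₃ and x₃y₁ are non-edges.
  -- (The domino is connected bipartite with a side-swapping automorphism,
  --  so this single pattern covers every induced copy.)
  InducedDomino : Fin m → Fin m → Fin m → Fin n → Fin n → Fin n → Set
  InducedDomino x₁ x₂ x₃ y₁ y₂ y₃ =
    (x₁ ≢ x₂) × (x₁ ≢ x₃) × (x₂ ≢ x₃) ×
    (y₁ ≢ y₂) × (y₁ ≢ y₃) × (y₂ ≢ y₃) ×
    Adj x₁ y₁ × Adj x₁ y₂ × ¬ Adj x₁ y₃ ×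
    Adj x₂ y₁ × Adj x₂ y₂ × Adj x₂ y₃ ×
    ¬ Adj x₃ y₁ × Adj x₃ y₂ × Adj x₃ y₃

  DominoFree : Set
  DominoFree = ∀ x₁ x₂ x₃ y₁ y₂ y₃ → ¬ InducedDomino x₁ x₂ x₃ y₁ y₂ y₃

  Pair : Set
  Pair = Subset m × Subset n

  X : Pair → Subset m
  X = proj₁

  Y : Pair → Subset n
  Y = proj₂

  IsBiclique : Pair → Set
  IsBiclique B = Nonempty (X B) × Nonempty (Y B) ×
                 (∀ x y → x ∈ X B → y ∈ Y B → Adj x y)

  IsMaxBiclique : Pair → Set
  IsMaxBiclique B = IsBiclique B ×
    (∀ B′ → IsBiclique B′ → X B ⊆ X B′ → Y B ⊆ Y B′ → (X B′ ⊆ X B) × (Y B′ ⊆ Y B))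

  botL : Pair
  botL = (∅ , full)

  topL : Pair
  topL = (full , ∅)

  InL : Pair → Set
  InL B = IsMaxBiclique B ⊎ B ≡ botL ⊎ B ≡ topL

  _≼_ : Pair → Pair → Set
  B ≼ B′ = X B ⊆ X B′

  Incomparable : Pair → Pair → Set
  Incomparable B B′ = ¬ (B ≼ B′) × ¬ (B′ ≼ B)

  IsMeet : Pair → Pair → Pair → Set
  IsMeet z a b = InL z × z ≼ a × z ≼ b ×
    (∀ w → InL w → w ≼ a → w ≼ b → w ≼ z)

  IsJoin : Pair → Pair → Pair → Set
  IsJoin z a b = InL z × a ≼ z × b ≼ z ×
    (∀ w → InL w → a ≼ w → b ≼ w → z ≼ w)

module Submission where

-- Suppose, for incomparable maximal bicliques B₁ and B₂, that
-- their meet M is not ⊥ and their join J is not ⊤; we build an induced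
-- domino.  Neither M = ⊤ (a vertex of Y(B₁) would be universal) nor J = ⊥
-- (X(B₁) is nonempty), so M and J are maximal bicliques.  Maximal bicliques
-- are closed: a vertex adjacent to one whole side already lies on the other
-- side; consequently X and Y are antitone on them.  This yields
--   x₂ ∈ X(M) ⊆ X(B₁) ∩ X(B₂),   y₂ ∈ Y(J) ⊆ Y(B₁) ∩ Y(B₂),
--   y₁ ∈ Y(B₁) ∖ Y(B₂),  y₃ ∈ Y(B₂) ∖ Y(B₁)   (by incomparability),
--   x₁ ∈ X(B₁) with x₁ ≁ y₃,  x₃ ∈ X(B₂) with x₃ ≁ y₁   (by closedness),
-- and these six vertices induce a domino with chord x₂y₂.

open import Defs
open import Data.Nat using (ℕ)
open import Data.Product using (_×_; _,_; proj₁; proj₂; ∃)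
open import Data.Sum using (inj₁; inj₂)
open import Data.Bool using (true)
import Data.Bool as Bool
open import Data.Empty using (⊥; ⊥-elim)
open import Data.Fin using (Fin)
open import Data.Fin.Subset using (_∈_; _∉_; _⊆_; _∪_; ⁅_⁆)
open import Data.Fin.Subset.Properties
  using (_∈?_; ∉⊥; ∈⊤; x∈⁅x⁆; x∈⁅y⁆⇒x≡y; x∈p∪q⁻; x∈p∪q⁺; p⊆p∪q)
open import Data.Fin.Properties using (¬∀⟶∃¬)
import Data.Vec.Properties as Vec
import Data.Product.Properties as Product
open import Relation.Nullary using (¬_; Dec)
open import Relation.Nullary.Decidable using (decidable-stable; _→-dec_)
open import Relation.Binary.PropositionalEquality using (_≡_; _≢_; refl; sym; subst)

counterexample : ∀ {k} {P Q : Fin k → Set} →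
                 (∀ i → Dec (P i)) → (∀ i → Dec (Q i)) →
                 ¬ (∀ i → P i → Q i) → ∃ λ i → P i × ¬ Q i
counterexample {k} P? Q? fails with ¬∀⟶∃¬ k _ (λ i → P? i →-dec Q? i) fails
... | i , ¬PQ = i , decidable-stable (P? i) (λ ¬p → ¬PQ (λ p → ⊥-elim (¬p p)))
                  , λ q → ¬PQ (λ _ → q)

module _ {m n : ℕ} (G : BipGraph m n) where

  adj? : ∀ x y → Dec (Adj G x y)
  adj? x y = G x y Bool.≟ true

  Complete : Pair G → Set
  Complete B = ∀ x y → x ∈ X G B → y ∈ Y G B → Adj G x y

  complete : ∀ {B} → IsMaxBiclique G B → Complete B
  complete ((_ , _ , c) , _) = c

  -- Closedness: a vertex of Y adjacent to all of X(B) lies in Y(B),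
  -- since otherwise (X(B), Y(B) ∪ {y}) would be a larger biclique.
  closedY : ∀ {B} → IsMaxBiclique G B →
            ∀ y → (∀ x → x ∈ X G B → Adj G x y) → y ∈ Y G B
  closedY {U , W} ((neU , (w , w∈W) , c) , maximal) y y-adj =
    proj₂ (maximal (U , W ∪ ⁅ y ⁆) (neU , (w , x∈p∪q⁺ (inj₁ w∈W)) , c′)
                   (λ x∈U → x∈U) (p⊆p∪q ⁅ y ⁆))
          (x∈p∪q⁺ (inj₂ (x∈⁅x⁆ y)))
    where
    c′ : Complete (U , W ∪ ⁅ y ⁆)
    c′ x y′ x∈U y′∈ with x∈p∪q⁻ W ⁅ y ⁆ y′∈
    ... | inj₁ y′∈W = c x y′ x∈U y′∈W
    ... | inj₂ y′∈y = subst (Adj G x) (sym (x∈⁅y⁆⇒x≡y y y′∈y)) (y-adj x x∈U)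

  closedX : ∀ {B} → IsMaxBiclique G B →
            ∀ x → (∀ y → y ∈ Y G B → Adj G x y) → x ∈ X G B
  closedX {U , W} (((u , u∈U) , neW , c) , maximal) x x-adj =
    proj₁ (maximal (U ∪ ⁅ x ⁆ , W) ((u , x∈p∪q⁺ (inj₁ u∈U)) , neW , c′)
                   (p⊆p∪q ⁅ x ⁆) (λ y∈W → y∈W))
          (x∈p∪q⁺ (inj₂ (x∈⁅x⁆ x)))
    where
    c′ : Complete (U ∪ ⁅ x ⁆ , W)
    c′ x′ y x′∈ y∈W with x∈p∪q⁻ U ⁅ x ⁆ x′∈
    ... | inj₁ x′∈U = c x′ y x′∈U y∈W
    ... | inj₂ x′∈x = subst (λ z → Adj G z y) (sym (x∈⁅y⁆⇒x≡y x x′∈x)) (x-adj y y∈W)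

  antitoneY : ∀ {B B′} → IsMaxBiclique G B → Complete B′ →
              X G B ⊆ X G B′ → Y G B′ ⊆ Y G B
  antitoneY maxB cB′ X⊆ {y} y∈ = closedY maxB y (λ x x∈ → cB′ x y (X⊆ x∈) y∈)

  antitoneX : ∀ {B B′} → IsMaxBiclique G B → Complete B′ →
              Y G B ⊆ Y G B′ → X G B′ ⊆ X G B
  antitoneX maxB cB′ Y⊆ {x} x∈ = closedX maxB x (λ y y∈ → cB′ x y x∈ (Y⊆ y∈))

  privateY : ∀ {B B′} → IsMaxBiclique G B → IsMaxBiclique G B′ →
             ¬ (X G B′ ⊆ X G B) → ∃ λ y → y ∈ Y G B × y ∉ Y G B′
  privateY {B} {B′} maxB maxB′ X⊈ =
    counterexample (_∈? Y G B) (_∈? Y G B′)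
      (λ Y⊆ → X⊈ (antitoneX maxB (complete maxB′) (λ {y} → Y⊆ y)))

  nonNeighbour : ∀ {B} → IsMaxBiclique G B →
                 ∀ y → y ∉ Y G B → ∃ λ x → x ∈ X G B × ¬ Adj G x y
  nonNeighbour {B} maxB y y∉ =
    counterexample (_∈? X G B) (λ x → adj? x y) (λ all → y∉ (closedY maxB y all))

  proper-isMax : ∀ {Z} → InL G Z → Z ≢ botL G → Z ≢ topL G → IsMaxBiclique G Z
  proper-isMax (inj₁ maxZ)        _   _   = maxZ
  proper-isMax (inj₂ (inj₁ Z≡⊥)) Z≢⊥ _   = ⊥-elim (Z≢⊥ Z≡⊥)
  proper-isMax (inj₂ (inj₂ Z≡⊤)) _   Z≢⊤ = ⊥-elim (Z≢⊤ Z≡⊤)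

  top-not-below : (∀ y → ¬ UniversalY G y) →
                  ∀ {B} → IsMaxBiclique G B → ¬ (_≼_ G (topL G) B)
  top-not-below noUnivY maxB@((_ , (y , y∈) , _) , _) ⊤≼B =
    noUnivY y (λ x → complete maxB x y (⊤≼B ∈⊤) y∈)

  not-below-bot : ∀ {B} → IsMaxBiclique G B → ¬ (_≼_ G B (botL G))
  not-below-bot (((x , x∈) , _) , _) B≼⊥ = ∉⊥ (B≼⊥ x∈)

  -- Six vertices with these nine (non-)adjacencies form an induced domino;
  -- the required distinctness is forced by the pattern itself.
  domino : ∀ {x₁ x₂ x₃ y₁ y₂ y₃} →
           Adj G x₁ y₁ → Adj G x₁ y₂ → ¬ Adj G x₁ y₃ →
           Adj G x₂ y₁ → Adj G x₂ y₂ → Adj G x₂ y₃ →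
           ¬ Adj G x₃ y₁ → Adj G x₃ y₂ → Adj G x₃ y₃ →
           InducedDomino G x₁ x₂ x₃ y₁ y₂ y₃
  domino a₁₁ a₁₂ n₁₃ a₂₁ a₂₂ a₂₃ n₃₁ a₃₂ a₃₃ =
    ( (λ { refl → n₁₃ a₂₃ }) , (λ { refl → n₁₃ a₃₃ }) , (λ { refl → n₃₁ a₂₁ })
    , (λ { refl → n₃₁ a₃₂ }) , (λ { refl → n₁₃ a₁₁ }) , (λ { refl → n₁₃ a₁₂ })
    , a₁₁ , a₁₂ , n₁₃ , a₂₁ , a₂₂ , a₂₃ , n₃₁ , a₃₂ , a₃₃ )

  no-proper-meet-and-join :
    NoUniversalVertex G → DominoFree G →
    ∀ {B₁ B₂ M J} → IsMaxBiclique G B₁ → IsMaxBiclique G B₂ →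
    Incomparable G B₁ B₂ → IsMeet G M B₁ B₂ → IsJoin G J B₁ B₂ →
    M ≢ botL G → J ≢ topL G → ⊥
  no-proper-meet-and-join (_ , noUnivY) dominoFree {B₁} {B₂} {M} {J}
    max₁ max₂ (B₁⋠B₂ , B₂⋠B₁) (M∈L , M≼B₁ , M≼B₂ , _) (J∈L , B₁≼J , B₂≼J , _) M≢⊥ J≢⊤
    with proper-isMax M∈L M≢⊥ (λ { refl → top-not-below noUnivY max₁ M≼B₁ })
       | proper-isMax J∈L (λ { refl → not-below-bot max₁ B₁≼J }) J≢⊤
  ... | maxM@(((x₂ , x₂∈M) , _) , _) | maxJ@((_ , (y₂ , y₂∈J) , _) , _)
    with privateY max₁ max₂ B₂⋠B₁ | privateY max₂ max₁ B₁⋠B₂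
  ... | y₁ , y₁∈₁ , y₁∉₂ | y₃ , y₃∈₂ , y₃∉₁
    with nonNeighbour max₁ y₃ y₃∉₁ | nonNeighbour max₂ y₁ y₁∉₂
  ... | x₁ , x₁∈₁ , n₁₃ | x₃ , x₃∈₂ , n₃₁ =
    dominoFree x₁ x₂ x₃ y₁ y₂ y₃
      (domino (c₁ x₁∈₁ y₁∈₁) (c₁ x₁∈₁ y₂∈₁) n₁₃
              (c₁ x₂∈₁ y₁∈₁) (c₁ x₂∈₁ y₂∈₁) (c₂ x₂∈₂ y₃∈₂)
              n₃₁ (c₂ x₃∈₂ y₂∈₂) (c₂ x₃∈₂ y₃∈₂))
    where
    c₁ : ∀ {x y} → x ∈ X G B₁ → y ∈ Y G B₁ → Adj G x y
    c₁ = complete max₁ _ _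
    c₂ : ∀ {x y} → x ∈ X G B₂ → y ∈ Y G B₂ → Adj G x y
    c₂ = complete max₂ _ _
    x₂∈₁ : x₂ ∈ X G B₁
    x₂∈₁ = M≼B₁ x₂∈M
    x₂∈₂ : x₂ ∈ X G B₂
    x₂∈₂ = M≼B₂ x₂∈M
    y₂∈₁ : y₂ ∈ Y G B₁
    y₂∈₁ = antitoneY max₁ (complete maxJ) B₁≼J y₂∈J
    y₂∈₂ : y₂ ∈ Y G B₂
    y₂∈₂ = antitoneY max₂ (complete maxJ) B₂≼J y₂∈J

  _≟ᴾ_ : (B B′ : Pair G) → Dec (B ≡ B′)
  _≟ᴾ_ = Product.≡-dec (Vec.≡-dec Bool._≟_) (Vec.≡-dec Bool._≟_)

lemma1 : (m n : ℕ) (G : BipGraph m n) →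
         NoUniversalVertex G → DominoFree G →
         (B₁ B₂ : Pair G) → IsMaxBiclique G B₁ → IsMaxBiclique G B₂ →
         Incomparable G B₁ B₂ →
         (M J : Pair G) → IsMeet G M B₁ B₂ → IsJoin G J B₁ B₂ →
         (M ≢ botL G → J ≡ topL G) × (J ≢ topL G → M ≡ botL G)
lemma1 m n G noUniv dominoFree B₁ B₂ max₁ max₂ incomparable M J meet join =
    (λ M≢⊥ → decidable-stable (_≟ᴾ_ G J (topL G)) (impossible M≢⊥))
  , (λ J≢⊤ → decidable-stable (_≟ᴾ_ G M (botL G)) (λ M≢⊥ → impossible M≢⊥ J≢⊤))
  where
  impossible : M ≢ botL G → J ≢ topL G → ⊥
  impossible = no-proper-meet-and-join G noUniv dominoFree max₁ max₂ incomparable meet join
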